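{- Any proper class of hypergraphs $\mathscr{H}$ (i.e. not containing all hypergraphs) which is closed under partial subhypergraphs (and isomorphism) has bounded VC-dimension: there is a constant $d$ such that $\textsc{VC-dim}(\mathcal{H})\le d$ for every $\mathcal{H}\in\mathscr{H}$.
   Context: A hypergraph $\mathcal{H}=(V,\mathcal{E})$ has $V$ finite and $\mathcal{E}\subseteq 2^V$. A set $U\subseteq V$ is shattered by $\mathcal{H}$ if for every $U'\subseteq U$ there is $F\in\mathcal{E}$ with $F\cap U=U'$; $\textsc{VC-dim}(\mathcal{H})$ is the maximum size of a shattered set. Given $V'\subseteq V$ and $\mathcal{E}'\subseteq\mathcal{E}$, the partial subhypergraph induced by $V'$ and $\mathcal{E}'$ is $(V',\{F\cap V'\mid F\in\mathcal{E}'\})$. -}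

module Defs where

open import Data.Nat using (ℕ; _≤_)
open import Data.Fin using (Fin)
open import Data.Fin.Subset using (Subset; _∩_; _⊆_; ∣_∣)
open import Data.Vec using (tabulate; lookup)
open import Data.List using (List)
open import Data.List.Membership.Propositional using (_∈_)
open import Data.List.Relation.Unary.All using (All)
open import Data.Product using (Σ; ∃; ∃-syntax; _×_)
open import Function using (Injective; Bijective; _⇔_)
open import Relation.Binary.PropositionalEquality using (_≡_)
open import Relation.Nullary using (¬_)

-- A (finite) hypergraph: vertex set V = Fin size, edge set given by a
-- list of subsets of V (only membership in the list matters).
record Hypergraph : Set where
  constructor hypergraph
  field
    size  : ℕ
    edges : List (Subset size)

open Hypergraph public

Shatters : (H : Hypergraph) → Subset (size H) → Set
Shatters H U = ∀ (U' : Subset (size H)) → U' ⊆ U →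
  ∃[ F ] (F ∈ edges H × F ∩ U ≡ U')

VCdim≤ : Hypergraph → ℕ → Set
VCdim≤ H d = ∀ (U : Subset (size H)) → Shatters H U → ∣ U ∣ ≤ d

preimage : ∀ {m n} → (Fin m → Fin n) → Subset n → Subset m
preimage f F = tabulate (λ i → lookup F (f i))

-- H' is (a copy of) the partial subhypergraph of H induced by V' and E':
-- V' is the image of the injection f : V(H') → V(H), E' ⊆ E(H), and the
-- edges of H' are exactly the traces F ∩ V' (transported along f) for F ∈ E'.
PartialSub : Hypergraph → Hypergraph → Set
PartialSub H' H =
  Σ (Fin (size H') → Fin (size H)) λ f → Injective _≡_ _≡_ f ×
  Σ (List (Subset (size H))) λ E' → All (_∈ edges H) E' ×
  (∀ (G : Subset (size H')) →
     (G ∈ edges H') ⇔ (∃[ F ] (F ∈ E' × G ≡ preimage f F)))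

Iso : Hypergraph → Hypergraph → Set
Iso H' H =
  Σ (Fin (size H') → Fin (size H)) λ f → Bijective _≡_ _≡_ f ×
  (∀ (G : Subset (size H')) →
     (G ∈ edges H') ⇔ (∃[ F ] (F ∈ edges H × G ≡ preimage f F)))

ClosedUnderIso : (Hypergraph → Set) → Set
ClosedUnderIso 𝒞 = ∀ H H' → Iso H' H → 𝒞 H → 𝒞 H'

ClosedUnderPartialSub : (Hypergraph → Set) → Set
ClosedUnderPartialSub 𝒞 = ∀ H H' → PartialSub H' H → 𝒞 H → 𝒞 H'

Proper : (Hypergraph → Set) → Set
Proper 𝒞 = ∃[ H ] ¬ 𝒞 H

{-# OPTIONS --safe #-}
-- If H shatters a set U with ∣ U ∣ ≥ size H₀, embed the vertices of H₀ injectively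
-- into U. Every edge G of H₀ then corresponds to a subset of U, which by shattering is
-- the trace on U of some edge of H; pulling these edges back along the embedding
-- recovers exactly G. So H₀ is a partial subhypergraph of H, and any H₀ outside a
-- class closed under partial subhypergraphs bounds the VC-dimension of its members
-- by its number of vertices.
module Submission where

open import Defs
open import Data.Nat using (ℕ)
open import Data.Product using (∃-syntax)

open import Data.Nat using (z≤n; s≤s; _≤_; _≤?_)
open import Data.Nat.Properties using (≰⇒≥)
open import Data.Bool using (true; false; _∧_)
open import Data.Bool.Properties using (∧-identityʳ)
open import Data.Fin using (Fin; zero; suc)
open import Data.Fin.Properties using (suc-injective)
open import Data.Fin.Subset using (Subset; _∩_; ∣_∣; ⊥)
open import Data.Fin.Subset.Properties using (p∩q⊆q)
open import Data.Vec using ([]; _∷_; lookup)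
open import Data.Vec.Properties using (tabulate-cong; lookup-zipWith)
open import Data.List using (map)
open import Data.List.Membership.Propositional using (_∈_)
open import Data.List.Membership.Propositional.Properties using (∈-map⁺; ∈-map⁻)
import Data.List.Relation.Unary.All as All
import Data.List.Relation.Unary.All.Properties as All
open import Data.Product using (_×_; _,_; proj₁; proj₂)
open import Function using (Injective; mk⇔)
open import Relation.Binary.PropositionalEquality
open import Relation.Nullary.Decidable using (decidable-stable)

preimage-∩-image⊆ : ∀ {m n} (f : Fin m → Fin n) {U : Subset n} →
                    (∀ i → lookup U (f i) ≡ true) →
                    ∀ A → preimage f (A ∩ U) ≡ preimage f A
preimage-∩-image⊆ f {U} f⊆U A = tabulate-cong λ i → begin
  lookup (A ∩ U) (f i)             ≡⟨ lookup-zipWith _∧_ (f i) A U ⟩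
  lookup A (f i) ∧ lookup U (f i)  ≡⟨ cong (lookup A (f i) ∧_) (f⊆U i) ⟩
  lookup A (f i) ∧ true            ≡⟨ ∧-identityʳ _ ⟩
  lookup A (f i)                   ∎
  where open ≡-Reasoning

embed : ∀ {m n} (U : Subset m) → n ≤ ∣ U ∣ → Fin n → Fin m
embed []          z≤n         ()
embed (false ∷ U) n≤∣U∣       i       = suc (embed U n≤∣U∣ i)
embed (true ∷ U)  (s≤s n≤∣U∣) zero    = zero
embed (true ∷ U)  (s≤s n≤∣U∣) (suc i) = suc (embed U n≤∣U∣ i)

embed-⊆ : ∀ {m n} (U : Subset m) (n≤∣U∣ : n ≤ ∣ U ∣) →
          ∀ i → lookup U (embed U n≤∣U∣ i) ≡ true
embed-⊆ []          z≤n         ()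
embed-⊆ (false ∷ U) n≤∣U∣       i       = embed-⊆ U n≤∣U∣ i
embed-⊆ (true ∷ U)  (s≤s n≤∣U∣) zero    = refl
embed-⊆ (true ∷ U)  (s≤s n≤∣U∣) (suc i) = embed-⊆ U n≤∣U∣ i

embed-injective : ∀ {m n} (U : Subset m) (n≤∣U∣ : n ≤ ∣ U ∣) →
                  Injective _≡_ _≡_ (embed U n≤∣U∣)
embed-injective []          z≤n         {()}
embed-injective (false ∷ U) n≤∣U∣       eq = embed-injective U n≤∣U∣ (suc-injective eq)
embed-injective (true ∷ U)  (s≤s n≤∣U∣) {zero}  {zero}  eq = refl
embed-injective (true ∷ U)  (s≤s n≤∣U∣) {suc i} {suc j} eq =
  cong suc (embed-injective U n≤∣U∣ (suc-injective eq))

preimage-embed-surjective : ∀ {m n} (U : Subset m) (n≤∣U∣ : n ≤ ∣ U ∣) →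
                            ∀ G → ∃[ A ] preimage (embed U n≤∣U∣) A ≡ G
preimage-embed-surjective []          z≤n         [] = ⊥ , refl
preimage-embed-surjective (true ∷ U)  z≤n         [] = ⊥ , refl
preimage-embed-surjective (false ∷ U) n≤∣U∣       G  =
  let A , eq = preimage-embed-surjective U n≤∣U∣ G in false ∷ A , eq
preimage-embed-surjective (true ∷ U)  (s≤s n≤∣U∣) (b ∷ G) =
  let A , eq = preimage-embed-surjective U n≤∣U∣ G in b ∷ A , cong (b ∷_) eq

module _ (H₀ H : Hypergraph) {U : Subset (size H)} (shatters : Shatters H U)
         (n≤∣U∣ : size H₀ ≤ ∣ U ∣) where

  private
    f : Fin (size H₀) → Fin (size H)
    f = embed U n≤∣U∣

  trace-realises : ∀ G → ∃[ F ] (F ∈ edges H × preimage f F ≡ G)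
  trace-realises G with preimage-embed-surjective U n≤∣U∣ G
  ... | A , f⁻¹A≡G with shatters (A ∩ U) (p∩q⊆q A U)
  ... | F , F∈H , F∩U≡A∩U = F , F∈H , (begin
    preimage f F        ≡⟨ preimage-∩-image⊆ f (embed-⊆ U n≤∣U∣) F ⟨
    preimage f (F ∩ U)  ≡⟨ cong (preimage f) F∩U≡A∩U ⟩
    preimage f (A ∩ U)  ≡⟨ preimage-∩-image⊆ f (embed-⊆ U n≤∣U∣) A ⟩
    preimage f A        ≡⟨ f⁻¹A≡G ⟩
    G                   ∎)
    where open ≡-Reasoning

  shattered⇒partialSub : PartialSub H₀ H
  shattered⇒partialSub =
    f , embed-injective U n≤∣U∣ ,
    map realiser (edges H₀) ,
    All.map⁺ (All.universal realiser-∈ (edges H₀)) ,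
    λ G → mk⇔ (λ G∈H₀ → realiser G , ∈-map⁺ realiser G∈H₀ , sym (realiser-pullback G))
              pullback-∈
    where
    realiser : Subset (size H₀) → Subset (size H)
    realiser G = proj₁ (trace-realises G)

    realiser-∈ : ∀ G → realiser G ∈ edges H
    realiser-∈ G = proj₁ (proj₂ (trace-realises G))

    realiser-pullback : ∀ G → preimage f (realiser G) ≡ G
    realiser-pullback G = proj₂ (proj₂ (trace-realises G))

    pullback-∈ : ∀ {G} → ∃[ F ] (F ∈ map realiser (edges H₀) × G ≡ preimage f F) →
                 G ∈ edges H₀
    pullback-∈ (F , F∈E' , refl) with ∈-map⁻ realiser F∈E'
    ... | G' , G'∈H₀ , refl = subst (_∈ edges H₀) (sym (realiser-pullback G')) G'∈H₀

proposition3 : (𝒞 : Hypergraph → Set) → Proper 𝒞 → ClosedUnderPartialSub 𝒞 → ClosedUnderIso 𝒞 →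
    ∃[ d ] (∀ (H : Hypergraph) → 𝒞 H → VCdim≤ H d)
proposition3 𝒞 (H₀ , H₀∉𝒞) closed _ = size H₀ , vc-bound
  where
  vc-bound : ∀ H → 𝒞 H → VCdim≤ H (size H₀)
  vc-bound H H∈𝒞 U shatters = decidable-stable (∣ U ∣ ≤? size H₀) λ ∣U∣≰ →
    H₀∉𝒞 (closed H H₀ (shattered⇒partialSub H₀ H shatters (≰⇒≥ ∣U∣≰)) H∈𝒞)
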